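{- Let $k$ and $r$ be positive integers with $k\geq 2$ and $1\leq r<k-1$, let $D$ be the diameter of $K(2k+r,k)$, and let $p\geq 1$ be an integer with $2p+1<D$. Let $A$ and $B$ be vertices of $K_{=2p+1}(2k+r,k)$ with $s=|A\cap B|\leq rp-r$. Then the distance between $A$ and $B$ in $K_{=2p+1}(2k+r,k)$ is $2$ if $s\geq k-2rp-r$, and $3$ if $s<k-2rp-r$.
   Context: For positive integers $n,k$, $[n]^k$ is the set of $k$-element subsets of $\{1,\dots,n\}$. The Kneser graph $K(2k+r,k)$ has vertex set $[2k+r]^k$, with $A,B$ adjacent iff $A\cap B=\emptyset$; it is connected. For a connected graph $G$ and positive integer $d$, the exact distance-$d$ graph $G_{=d}$ has the same vertex set as $G$, with two vertices adjacent iff their distance in $G$ is exactly $d$. $K_{=d}(2k+r,k)$ denotes the exact distance-$d$ graph of $K(2k+r,k)$. (The diameter of $K(2k+r,k)$ is $\lceil (k-1)/r\rceil+1$.) -}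

module Defs where

open import Data.Nat using (ℕ; zero; suc; _+_; _*_; _<_; _≤_)
open import Data.Fin.Subset using (Subset; ∣_∣; _∩_; ⊥)
open import Data.Product using (Σ; ∃; _×_; _,_; proj₁)
open import Relation.Binary.PropositionalEquality using (_≡_)
open import Relation.Nullary using (¬_)

data Walk {V : Set} (E : V → V → Set) : V → V → ℕ → Set where
  here : ∀ {u} → Walk E u u 0
  step : ∀ {u v w n} → E u v → Walk E v w n → Walk E u w (suc n)

Dist : {V : Set} → (V → V → Set) → V → V → ℕ → Set
Dist E u v d = Walk E u v d × (∀ m → m < d → ¬ Walk E u v m)

IsDiameter : {V : Set} → (V → V → Set) → ℕ → Set
IsDiameter {V} E D =
  (Σ V λ u → Σ V λ v → Dist E u v D) ×
  (∀ u v → Σ ℕ λ d → d ≤ D × Dist E u v d)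

ExactDist : {V : Set} → (V → V → Set) → ℕ → V → V → Set
ExactDist E d u v = Dist E u v d

KSet : ℕ → ℕ → Set
KSet n k = Σ (Subset n) λ A → ∣ A ∣ ≡ k

KneserAdj : (n k : ℕ) → KSet n k → KSet n k → Set
KneserAdj n k A B = proj₁ A ∩ proj₁ B ≡ ⊥

interSize : {n k : ℕ} → KSet n k → KSet n k → ℕ
interSize A B = ∣ proj₁ A ∩ proj₁ B ∣

-- Write t = |X ∩ Y|. The neighbours of X in K(2k+r,k) meet Y in every size from k − r − t to
-- k − t, so by induction X and Y are joined by a walk of length 2q+1 iff t ≤ rq, and by one of
-- length 2q (q ≥ 1) iff k ≤ t + rq. A diameter above 2p+1 therefore forces k > 2rp+1, and then
-- E = K_{=2p+1} joins exactly the pairs with r(p−1) < t ≤ rp. A vertex C meeting A and B in rp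
-- points each is a common E-neighbour as soon as k ≤ 2rp + r + s, whereas the Bonferroni
-- inequality 3k ≤ (2k+r) + |C∩A| + |C∩B| + |A∩B| excludes common E-neighbours when
-- s < k − 2rp − r; one first E-step to a C with |A∩C| = rp, |C∩B| = k − rp − r lands in the
-- former case.

module Submission where

open import Defs
open import Data.Bool using (Bool; true; false; _∧_; not)
open import Data.Fin.Subset using (Subset; ∣_∣; _∩_; ⊥; ∁)
open import Data.Fin.Subset.Properties using (∩-comm; ∩-idem; ∣⊥∣≡0; ∣∁p∣≡n∸∣p∣; ∣p∩q∣≤∣p∣)
open import Data.Nat
open import Data.Nat.Properties
open import Algebra.Properties.CommutativeSemigroup +-commutativeSemigroup
  using () renaming (interchange to +-interchange; xy∙z≈xz∙y to m+n+o≡m+o+n; xy∙z≈x∙zy to m+n+o≡m+[o+n])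
open import Data.Nat.Tactic.RingSolver using (solve-∀)
open import Data.Product using (Σ; _×_; _,_; proj₁)
open import Data.Sum using (_⊎_; inj₁; inj₂; [_,_]′)
open import Data.Vec using ([]; _∷_)
open import Data.Vec.Properties using (∷-injective)
open import Relation.Binary.PropositionalEquality
open import Relation.Nullary using (¬_; yes; no)

bit : Bool → ℕ
bit true  = 1
bit false = 0

∣x∷p∣≡bit+∣p∣ : ∀ {n} x (p : Subset n) → ∣ x ∷ p ∣ ≡ bit x + ∣ p ∣
∣x∷p∣≡bit+∣p∣ true  _ = refl
∣x∷p∣≡bit+∣p∣ false _ = refl

∣p∣≡0⇒p≡⊥ : ∀ {n} (p : Subset n) → ∣ p ∣ ≡ 0 → p ≡ ⊥
∣p∣≡0⇒p≡⊥ []          _     = refl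
∣p∣≡0⇒p≡⊥ (false ∷ p) ∣p∣≡0 = cong (false ∷_) (∣p∣≡0⇒p≡⊥ p ∣p∣≡0)

∣p∩q∣+∣p∩∁q∣≡∣p∣ : ∀ {n} (p q : Subset n) → ∣ p ∩ q ∣ + ∣ p ∩ ∁ q ∣ ≡ ∣ p ∣
∣p∩q∣+∣p∩∁q∣≡∣p∣ []      []      = refl
∣p∩q∣+∣p∩∁q∣≡∣p∣ (x ∷ p) (y ∷ q)
  rewrite ∣x∷p∣≡bit+∣p∣ (x ∧ y) (p ∩ q) | ∣x∷p∣≡bit+∣p∣ (x ∧ not y) (p ∩ ∁ q) | ∣x∷p∣≡bit+∣p∣ x p =
  trans (+-interchange (bit (x ∧ y)) (∣ p ∩ q ∣) (bit (x ∧ not y)) (∣ p ∩ ∁ q ∣)) (cong₂ _+_ (pointwise x y) (∣p∩q∣+∣p∩∁q∣≡∣p∣ p q))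
  where
  pointwise : ∀ x y → bit (x ∧ y) + bit (x ∧ not y) ≡ bit x
  pointwise true  true  = refl
  pointwise true  false = refl
  pointwise false _     = refl

∣p∩s∣+∣q∩s∣≤∣s∣ : ∀ {n} (p q s : Subset n) → p ∩ q ≡ ⊥ → ∣ p ∩ s ∣ + ∣ q ∩ s ∣ ≤ ∣ s ∣
∣p∩s∣+∣q∩s∣≤∣s∣ []      []      []      _ = z≤n
∣p∩s∣+∣q∩s∣≤∣s∣ (x ∷ p) (y ∷ q) (z ∷ s) x∷p∩y∷q≡⊥
  with ∷-injective x∷p∩y∷q≡⊥
... | x∧y≡false , p∩q≡⊥
  rewrite ∣x∷p∣≡bit+∣p∣ (x ∧ z) (p ∩ s) | ∣x∷p∣≡bit+∣p∣ (y ∧ z) (q ∩ s) | ∣x∷p∣≡bit+∣p∣ z s =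
  subst (_≤ bit z + ∣ s ∣) (sym (+-interchange (bit (x ∧ z)) (∣ p ∩ s ∣) (bit (y ∧ z)) (∣ q ∩ s ∣)))
    (+-mono-≤ (pointwise x y z x∧y≡false) (∣p∩s∣+∣q∩s∣≤∣s∣ p q s p∩q≡⊥))
  where
  pointwise : ∀ x y z → x ∧ y ≡ false → bit (x ∧ z) + bit (y ∧ z) ≤ bit z
  pointwise true  false z     _ = ≤-reflexive (+-identityʳ (bit z))
  pointwise false true  true  _ = ≤-refl
  pointwise false true  false _ = z≤n
  pointwise false false z     _ = z≤n

bonferroni : ∀ {n} (p q s : Subset n) →
             ∣ p ∣ + ∣ q ∣ + ∣ s ∣ ≤ n + ∣ p ∩ q ∣ + ∣ p ∩ s ∣ + ∣ q ∩ s ∣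
bonferroni []      []      []      = z≤n
bonferroni {suc n} (x ∷ p) (y ∷ q) (z ∷ s)
  rewrite ∣x∷p∣≡bit+∣p∣ x p | ∣x∷p∣≡bit+∣p∣ y q | ∣x∷p∣≡bit+∣p∣ z s
        | ∣x∷p∣≡bit+∣p∣ (x ∧ y) (p ∩ q) | ∣x∷p∣≡bit+∣p∣ (x ∧ z) (p ∩ s)
        | ∣x∷p∣≡bit+∣p∣ (y ∧ z) (q ∩ s) =
  subst₂ _≤_ (interleave₃ (bit x) (bit y) (bit z) (∣ p ∣) (∣ q ∣) (∣ s ∣))
             (interleave₄ 1 (bit (x ∧ y)) (bit (x ∧ z)) (bit (y ∧ z)) n (∣ p ∩ q ∣) (∣ p ∩ s ∣) (∣ q ∩ s ∣))
    (+-mono-≤ (pointwise x y z) (bonferroni p q s))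
  where
  pointwise : ∀ x y z → bit x + bit y + bit z ≤ 1 + bit (x ∧ y) + bit (x ∧ z) + bit (y ∧ z)
  pointwise true  true  true  = n≤1+n 3
  pointwise true  true  false = ≤-refl
  pointwise true  false true  = ≤-refl
  pointwise true  false false = ≤-refl
  pointwise false true  true  = ≤-refl
  pointwise false true  false = ≤-refl
  pointwise false false true  = ≤-refl
  pointwise false false false = z≤n
  interleave₃ : ∀ a b c A B C → (a + b + c) + (A + B + C) ≡ (a + A) + (b + B) + (c + C)
  interleave₃ = solve-∀
  interleave₄ : ∀ a b c d A B C D → (a + b + c + d) + (A + B + C + D) ≡ (a + A) + (b + B) + (c + C) + (d + D)
  interleave₄ = solve-∀

SubsetWithOverlaps : ∀ {n} → Subset n → Subset n → ℕ → ℕ → ℕ → Set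
SubsetWithOverlaps {n} p q b c d =
  Σ (Subset n) λ s → ∣ s ∣ ≡ b + c + d × ∣ s ∩ p ∣ ≡ b × ∣ s ∩ q ∣ ≡ c

false∷ : ∀ {n x y} {p q : Subset n} {b c d} →
         SubsetWithOverlaps p q b c d → SubsetWithOverlaps (x ∷ p) (y ∷ q) b c d
false∷ (s , ∣s∣≡ , ∣s∩p∣≡ , ∣s∩q∣≡) = false ∷ s , ∣s∣≡ , ∣s∩p∣≡ , ∣s∩q∣≡

chooseSubsetWithOverlaps : ∀ {n} (p q : Subset n) {b c d} →
  b ≤ ∣ p ∩ ∁ q ∣ → c ≤ ∣ q ∩ ∁ p ∣ → d ≤ ∣ ∁ p ∩ ∁ q ∣ → SubsetWithOverlaps p q b c d
chooseSubsetWithOverlaps [] [] z≤n z≤n z≤n = [] , refl , refl , refl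
chooseSubsetWithOverlaps (true ∷ p) (true ∷ q) hb hc hd =
  false∷ (chooseSubsetWithOverlaps p q hb hc hd)
chooseSubsetWithOverlaps (true ∷ p) (false ∷ q) {zero} _ hc hd =
  false∷ (chooseSubsetWithOverlaps p q z≤n hc hd)
chooseSubsetWithOverlaps (true ∷ p) (false ∷ q) {suc b} (s≤s hb) hc hd
  with chooseSubsetWithOverlaps p q hb hc hd
... | s , ∣s∣≡ , ∣s∩p∣≡ , ∣s∩q∣≡ =
  true ∷ s , cong suc ∣s∣≡ , cong suc ∣s∩p∣≡ , ∣s∩q∣≡
chooseSubsetWithOverlaps (false ∷ p) (true ∷ q) {c = zero} hb _ hd =
  false∷ (chooseSubsetWithOverlaps p q hb z≤n hd)
chooseSubsetWithOverlaps (false ∷ p) (true ∷ q) {b} {suc c} {d} hb (s≤s hc) hd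
  with chooseSubsetWithOverlaps p q hb hc hd
... | s , ∣s∣≡ , ∣s∩p∣≡ , ∣s∩q∣≡ =
  true ∷ s , trans (cong suc ∣s∣≡) (cong (_+ d) (sym (+-suc b c))) , ∣s∩p∣≡ , cong suc ∣s∩q∣≡
chooseSubsetWithOverlaps (false ∷ p) (false ∷ q) {d = zero} hb hc _ =
  false∷ (chooseSubsetWithOverlaps p q hb hc z≤n)
chooseSubsetWithOverlaps (false ∷ p) (false ∷ q) {b} {c} {suc d} hb hc (s≤s hd)
  with chooseSubsetWithOverlaps p q hb hc hd
... | s , ∣s∣≡ , ∣s∩p∣≡ , ∣s∩q∣≡ =
  true ∷ s , trans (cong suc ∣s∣≡) (sym (+-suc (b + c) d)) , ∣s∩p∣≡ , ∣s∩q∣≡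

evenOrOdd : ∀ m → (Σ ℕ λ q → m ≡ q + q) ⊎ (Σ ℕ λ q → m ≡ suc (q + q))
evenOrOdd zero = inj₁ (0 , refl)
evenOrOdd (suc m) with evenOrOdd m
... | inj₁ (q , m≡q+q)      = inj₂ (q , cong suc m≡q+q)
... | inj₂ (q , m≡suc[q+q]) = inj₁ (suc q , cong suc (trans m≡suc[q+q] (sym (+-suc q q))))

m+m≤n+n⇒m≤n : ∀ {m n} → m + m ≤ n + n → m ≤ n
m+m≤n+n⇒m≤n m+m≤n+n = ≮⇒≥ λ n<m → <⇒≱ (+-mono-< n<m n<m) m+m≤n+n

m+m<n+n⇒m<n : ∀ {m n} → m + m < n + n → m < n
m+m<n+n⇒m<n m+m<n+n = ≰⇒> λ n≤m → <⇒≱ m+m<n+n (+-mono-≤ n≤m n≤m)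

2n+1≡suc[n+n] : ∀ n → 2 * n + 1 ≡ suc (n + n)
2n+1≡suc[n+n] = solve-∀

module Kneser (k r : ℕ) where

  Vertex : Set
  Vertex = KSet (2 * k + r) k

  Adj : Vertex → Vertex → Set
  Adj = KneserAdj (2 * k + r) k

  ∣X∩Y∣≡∣Y∩X∣ : (X Y : Vertex) → interSize X Y ≡ interSize Y X
  ∣X∩Y∣≡∣Y∩X∣ (p , _) (q , _) = cong ∣_∣ (∩-comm p q)

  ∣X∩X∣≡k : (X : Vertex) → interSize X X ≡ k
  ∣X∩X∣≡k (p , ∣p∣≡k) = trans (cong ∣_∣ (∩-idem p)) ∣p∣≡k

  ∣X∩Y∣≤k : (X Y : Vertex) → interSize X Y ≤ k
  ∣X∩Y∣≤k (p , ∣p∣≡k) (q , _) = subst (∣ p ∩ q ∣ ≤_) ∣p∣≡k (∣p∩q∣≤∣p∣ p q)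

  Adj⇒∣X∩Y∣≡0 : (X Y : Vertex) → Adj X Y → interSize X Y ≡ 0
  Adj⇒∣X∩Y∣≡0 _ _ p∩q≡⊥ = trans (cong ∣_∣ p∩q≡⊥) (∣⊥∣≡0 (2 * k + r))

  ∣X∩Y∣≡0⇒Adj : (X Y : Vertex) → interSize X Y ≡ 0 → Adj X Y
  ∣X∩Y∣≡0⇒Adj X Y = ∣p∣≡0⇒p≡⊥ (proj₁ X ∩ proj₁ Y)

  ∣X∖Y∣+∣X∩Y∣≡k : (X Y : Vertex) → ∣ proj₁ X ∩ ∁ (proj₁ Y) ∣ + interSize X Y ≡ k
  ∣X∖Y∣+∣X∩Y∣≡k (p , ∣p∣≡k) (q , _) =
    trans (+-comm (∣ p ∩ ∁ q ∣) (∣ p ∩ q ∣)) (trans (∣p∩q∣+∣p∩∁q∣≡∣p∣ p q) ∣p∣≡k)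

  ∣∁X∩∁Y∣≡r+∣X∩Y∣ : (X Y : Vertex) → ∣ ∁ (proj₁ X) ∩ ∁ (proj₁ Y) ∣ ≡ r + interSize X Y
  ∣∁X∩∁Y∣≡r+∣X∩Y∣ X@(p , ∣p∣≡k) Y@(q , _) = +-cancelˡ-≡ ∣Y∖X∣ _ _ (begin
    ∣Y∖X∣ + ∣ ∁ p ∩ ∁ q ∣          ≡⟨ cong (_+ ∣ ∁ p ∩ ∁ q ∣) (cong ∣_∣ (∩-comm q (∁ p))) ⟩
    ∣ ∁ p ∩ q ∣ + ∣ ∁ p ∩ ∁ q ∣    ≡⟨ ∣p∩q∣+∣p∩∁q∣≡∣p∣ (∁ p) q ⟩
    ∣ ∁ p ∣                        ≡⟨ ∣∁p∣≡n∸∣p∣ p ⟩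
    2 * k + r ∸ ∣ p ∣              ≡⟨ cong (2 * k + r ∸_) ∣p∣≡k ⟩
    2 * k + r ∸ k                  ≡⟨ cong (_∸ k) (2k+r≡k+[k+r] k r) ⟩
    k + (k + r) ∸ k                ≡⟨ m+n∸m≡n k (k + r) ⟩
    k + r                          ≡⟨ cong (_+ r) (sym (∣X∖Y∣+∣X∩Y∣≡k Y X)) ⟩
    ∣Y∖X∣ + interSize Y X + r      ≡⟨ cong (λ t → ∣Y∖X∣ + t + r) (∣X∩Y∣≡∣Y∩X∣ Y X) ⟩
    ∣Y∖X∣ + interSize X Y + r      ≡⟨ m+n+o≡m+[o+n] ∣Y∖X∣ (interSize X Y) r ⟩
    ∣Y∖X∣ + (r + interSize X Y)    ∎)
    where
    open ≡-Reasoning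
    ∣Y∖X∣ = ∣ q ∩ ∁ p ∣
    2k+r≡k+[k+r] : ∀ k r → 2 * k + r ≡ k + (k + r)
    2k+r≡k+[k+r] = solve-∀

  Adj⇒∣X∩Y∣+∣Z∩Y∣≤k : (X Z Y : Vertex) → Adj X Z → interSize X Y + interSize Z Y ≤ k
  Adj⇒∣X∩Y∣+∣Z∩Y∣≤k (p , _) (q , _) (s , ∣s∣≡k) p∩q≡⊥ =
    subst (∣ p ∩ s ∣ + ∣ q ∩ s ∣ ≤_) ∣s∣≡k (∣p∩s∣+∣q∩s∣≤∣s∣ p q s p∩q≡⊥)

  k≤r+∣X∩Y∣+∣X∩Z∣+∣Y∩Z∣ : (X Y Z : Vertex) →
    k ≤ r + interSize X Y + interSize X Z + interSize Y Z
  k≤r+∣X∩Y∣+∣X∩Z∣+∣Y∩Z∣ (p , ∣p∣≡k) (q , ∣q∣≡k) (s , ∣s∣≡k) =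
    +-cancelʳ-≤ (k + k) k _ (begin
      k + (k + k)                                          ≡⟨ +-assoc k k k ⟨
      k + k + k                                            ≡⟨ cong₂ _+_ (cong₂ _+_ ∣p∣≡k ∣q∣≡k) ∣s∣≡k ⟨
      ∣ p ∣ + ∣ q ∣ + ∣ s ∣                                ≤⟨ bonferroni p q s ⟩
      2 * k + r + ∣ p ∩ q ∣ + ∣ p ∩ s ∣ + ∣ q ∩ s ∣        ≡⟨ rearrange k r (∣ p ∩ q ∣) (∣ p ∩ s ∣) (∣ q ∩ s ∣) ⟩
      r + ∣ p ∩ q ∣ + ∣ p ∩ s ∣ + ∣ q ∩ s ∣ + (k + k)      ∎)
    where
    open ≤-Reasoning
    rearrange : ∀ k r a b c → 2 * k + r + a + b + c ≡ r + a + b + c + (k + k)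
    rearrange = solve-∀

  vertexWithOverlaps : (X Y : Vertex) {b c d : ℕ} →
    b + interSize X Y ≤ k → c + interSize X Y ≤ k → d ≤ r + interSize X Y → b + c + d ≡ k →
    Σ Vertex λ Z → interSize Z X ≡ b × interSize Z Y ≡ c
  vertexWithOverlaps X Y {b} {c} {d} b+t≤k c+t≤k d≤r+t b+c+d≡k =
    let s , ∣s∣≡b+c+d , ∣s∩p∣≡b , ∣s∩q∣≡c = chooseSubsetWithOverlaps (proj₁ X) (proj₁ Y) hb hc hd
    in (s , trans ∣s∣≡b+c+d b+c+d≡k) , ∣s∩p∣≡b , ∣s∩q∣≡c
    where
    hb : b ≤ ∣ proj₁ X ∩ ∁ (proj₁ Y) ∣
    hb = +-cancelʳ-≤ _ b _ (subst (b + interSize X Y ≤_) (sym (∣X∖Y∣+∣X∩Y∣≡k X Y)) b+t≤k)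
    hc : c ≤ ∣ proj₁ Y ∩ ∁ (proj₁ X) ∣
    hc = +-cancelʳ-≤ _ c _ (subst₂ (λ t k′ → c + t ≤ k′) (∣X∩Y∣≡∣Y∩X∣ X Y) (sym (∣X∖Y∣+∣X∩Y∣≡k Y X)) c+t≤k)
    hd : d ≤ ∣ ∁ (proj₁ X) ∩ ∁ (proj₁ Y) ∣
    hd = subst (d ≤_) (sym (∣∁X∩∁Y∣≡r+∣X∩Y∣ X Y)) d≤r+t

  neighbourWithOverlap : (X Y : Vertex) {c : ℕ} →
    k ∸ (r + interSize X Y) ≤ c → c ≤ k ∸ interSize X Y → Σ Vertex λ Z → Adj X Z × interSize Z Y ≡ c
  neighbourWithOverlap X Y {c} lower upper =
    let Z , ∣Z∩X∣≡0 , ∣Z∩Y∣≡c = vertexWithOverlaps X Y {0} (∣X∩Y∣≤k X Y)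
                                  (m≤o∸n⇒m+n≤o c (∣X∩Y∣≤k X Y) upper) d≤r+t (m+[n∸m]≡n c≤k)
    in Z , ∣X∩Y∣≡0⇒Adj X Z (trans (∣X∩Y∣≡∣Y∩X∣ X Z) ∣Z∩X∣≡0) , ∣Z∩Y∣≡c
    where
    t = interSize X Y
    c≤k : c ≤ k
    c≤k = ≤-trans upper (m∸n≤m k t)
    d≤r+t : k ∸ c ≤ r + t
    d≤r+t = m≤n+o⇒m∸n≤o k c (begin
      k                        ≤⟨ m≤n+m∸n k (r + t) ⟩
      r + t + (k ∸ (r + t))    ≤⟨ +-monoʳ-≤ (r + t) lower ⟩
      r + t + c                ≡⟨ +-comm (r + t) c ⟩
      c + (r + t)              ∎)
      where open ≤-Reasoning

  ∣X∩Y∣≤rq⇒oddWalk : ∀ q {X Y} → interSize X Y ≤ r * q → Walk Adj X Y (suc (q + q))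
  k≤∣X∩Y∣+rq⇒evenWalk : ∀ q {X Y} → k ≤ interSize X Y + r * suc q → Walk Adj X Y (suc q + suc q)

  ∣X∩Y∣≤rq⇒oddWalk zero {X} {Y} t≤0 =
    step (∣X∩Y∣≡0⇒Adj X Y (n≤0⇒n≡0 (subst (interSize X Y ≤_) (*-zeroʳ r) t≤0))) here
  ∣X∩Y∣≤rq⇒oddWalk (suc q) {X} {Y} t≤r[q+1] =
    let Z , X~Z , ∣Z∩Y∣≡k∸t = neighbourWithOverlap X Y (∸-monoʳ-≤ k (m≤n+m t r)) ≤-refl
    in step {v = Z} X~Z (k≤∣X∩Y∣+rq⇒evenWalk q (begin
      k                            ≤⟨ m≤n+m∸n k t ⟩
      t + (k ∸ t)                  ≤⟨ +-monoˡ-≤ (k ∸ t) t≤r[q+1] ⟩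
      r * suc q + (k ∸ t)          ≡⟨ +-comm (r * suc q) (k ∸ t) ⟩
      k ∸ t + r * suc q            ≡⟨ cong (_+ r * suc q) (sym ∣Z∩Y∣≡k∸t) ⟩
      interSize Z Y + r * suc q    ∎))
    where
    open ≤-Reasoning
    t = interSize X Y

  k≤∣X∩Y∣+rq⇒evenWalk q {X} {Y} k≤t+r[q+1] =
    let Z , X~Z , ∣Z∩Y∣≡k∸[r+t] = neighbourWithOverlap X Y ≤-refl (∸-monoʳ-≤ k (m≤n+m t r))
    in subst (Walk Adj X Y) (cong suc (sym (+-suc q q)))
         (step {v = Z} X~Z (∣X∩Y∣≤rq⇒oddWalk q (subst (_≤ r * q) (sym ∣Z∩Y∣≡k∸[r+t]) k∸[r+t]≤rq)))
    where
    open ≤-Reasoning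
    t = interSize X Y
    rearrange : ∀ t r q → t + r * suc q ≡ r + t + r * q
    rearrange = solve-∀
    k∸[r+t]≤rq : k ∸ (r + t) ≤ r * q
    k∸[r+t]≤rq = m≤n+o⇒m∸n≤o k (r + t) (begin
      k                ≤⟨ k≤t+r[q+1] ⟩
      t + r * suc q    ≡⟨ rearrange t r q ⟩
      r + t + r * q    ∎)

  oddWalk⇒∣X∩Y∣≤rq : ∀ q {X Y} → Walk Adj X Y (suc (q + q)) → interSize X Y ≤ r * q
  evenWalk⇒k≤∣X∩Y∣+rq : ∀ q {X Y} → Walk Adj X Y (q + q) → k ≤ interSize X Y + r * q

  oddWalk⇒∣X∩Y∣≤rq q {X} {Y} (step {v = Z} X~Z Z⇝Y) =
    +-cancelʳ-≤ (interSize Z Y) (interSize X Y) (r * q) (begin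
      interSize X Y + interSize Z Y    ≤⟨ Adj⇒∣X∩Y∣+∣Z∩Y∣≤k X Z Y X~Z ⟩
      k                                ≤⟨ evenWalk⇒k≤∣X∩Y∣+rq q Z⇝Y ⟩
      interSize Z Y + r * q            ≡⟨ +-comm (interSize Z Y) (r * q) ⟩
      r * q + interSize Z Y            ∎)
    where open ≤-Reasoning

  evenWalk⇒k≤∣X∩Y∣+rq zero {X} here =
    ≤-reflexive (sym (trans (cong (interSize X X +_) (*-zeroʳ r)) (trans (+-identityʳ _) (∣X∩X∣≡k X))))
  evenWalk⇒k≤∣X∩Y∣+rq (suc q) {X} {Y} (step {v = Z} X~Z Z⇝Y) = begin
    k                                      ≤⟨ k≤r+∣X∩Y∣+∣X∩Z∣+∣Y∩Z∣ X Z Y ⟩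
    r + interSize X Z + t + interSize Z Y  ≡⟨ cong (λ a → r + a + t + interSize Z Y) (Adj⇒∣X∩Y∣≡0 X Z X~Z) ⟩
    r + 0 + t + interSize Z Y              ≤⟨ +-monoʳ-≤ (r + 0 + t) ∣Z∩Y∣≤rq ⟩
    r + 0 + t + r * q                      ≡⟨ rearrange r t q ⟩
    t + r * suc q                          ∎
    where
    open ≤-Reasoning
    t = interSize X Y
    ∣Z∩Y∣≤rq : interSize Z Y ≤ r * q
    ∣Z∩Y∣≤rq = oddWalk⇒∣X∩Y∣≤rq q (subst (Walk Adj Z Y) (+-suc q q) Z⇝Y)
    rearrange : ∀ r t q → r + 0 + t + r * q ≡ t + r * suc q
    rearrange = solve-∀

  k≤2rp+1⇒shortWalk : ∀ p′ → let p = suc p′ in k ≤ suc (r * p + r * p) →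
              (X Y : Vertex) → Walk Adj X Y (suc (p + p)) ⊎ Walk Adj X Y (p + p)
  k≤2rp+1⇒shortWalk p′ k≤2rp+1 X Y with interSize X Y ≤? r * suc p′
  ... | yes t≤rp = inj₁ (∣X∩Y∣≤rq⇒oddWalk (suc p′) t≤rp)
  ... | no  t≰rp = inj₂ (k≤∣X∩Y∣+rq⇒evenWalk p′ (≤-trans k≤2rp+1 (+-monoˡ-≤ (r * suc p′) (≰⇒> t≰rp))))

  diameter⇒2rp+1<k : ∀ p′ {D} → let p = suc p′ in
                     IsDiameter Adj D → suc (p + p) < D → suc (r * p + r * p) < k
  diameter⇒2rp+1<k p′ ((X , Y , _ , noShorter) , _) 2p+1<D = ≰⇒> λ k≤2rp+1 →
    [ noShorter _ 2p+1<D , noShorter _ (<-trans (n<1+n _) 2p+1<D) ]′ (k≤2rp+1⇒shortWalk p′ k≤2rp+1 X Y)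

  module ExactDistance (p′ : ℕ) (r≥1 : 1 ≤ r) (2P<k : r * suc p′ + r * suc p′ < k) where

    p R P : ℕ
    p = suc p′
    R = r * p′
    P = r * p

    E : Vertex → Vertex → Set
    E = ExactDist Adj (2 * p + 1)

    R<P : R < P
    R<P = subst (R <_) (sym (*-suc r p′)) (m<n+m R r≥1)

    P+P≤k : P + P ≤ k
    P+P≤k = <⇒≤ 2P<k

    P<k : P < k
    P<k = ≤-<-trans (m≤m+n P P) 2P<k

    R<∣X∩Y∣≤P⇒E : (X Y : Vertex) → R < interSize X Y → interSize X Y ≤ P → E X Y
    R<∣X∩Y∣≤P⇒E X Y R<t t≤P =
      subst (Dist Adj X Y) (sym (2n+1≡suc[n+n] p)) (∣X∩Y∣≤rq⇒oddWalk p t≤P , noShorter)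
      where
      noShorter : ∀ m → m < suc (p + p) → ¬ Walk Adj X Y m
      noShorter m m<2p+1 w with evenOrOdd m
      ... | inj₁ (q , refl) = <⇒≱ 2P<k (begin
        k                     ≤⟨ evenWalk⇒k≤∣X∩Y∣+rq q w ⟩
        interSize X Y + r * q ≤⟨ +-mono-≤ t≤P (*-monoʳ-≤ r (m+m≤n+n⇒m≤n (≤-pred m<2p+1))) ⟩
        P + P                 ∎)
        where open ≤-Reasoning
      ... | inj₂ (q , refl) = <⇒≱ R<t (begin
        interSize X Y         ≤⟨ oddWalk⇒∣X∩Y∣≤rq q w ⟩
        r * q                 ≤⟨ *-monoʳ-≤ r (≤-pred (m+m<n+n⇒m<n (≤-pred m<2p+1))) ⟩
        R                     ∎)
        where open ≤-Reasoning

    E⇒∣X∩Y∣≤P : (X Y : Vertex) → E X Y → interSize X Y ≤ P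
    E⇒∣X∩Y∣≤P X Y (w , _) = oddWalk⇒∣X∩Y∣≤rq p (subst (Walk Adj X Y) (2n+1≡suc[n+n] p) w)

    ∣X∩Y∣≤R⇒¬E : (X Y : Vertex) → interSize X Y ≤ R → ¬ E X Y
    ∣X∩Y∣≤R⇒¬E X Y t≤R (_ , noShorter) =
      noShorter (suc (p′ + p′)) 2p′+1<2p+1 (∣X∩Y∣≤rq⇒oddWalk p′ t≤R)
      where
      2p′+1<2p+1 : suc (p′ + p′) < 2 * p + 1
      2p′+1<2p+1 = subst (suc (p′ + p′) <_) (sym (2n+1≡suc[n+n] p)) (s≤s (s≤s (+-monoʳ-≤ p′ (n≤1+n p′))))

    ∣X∩Y∣≡P⇒E : (X Y : Vertex) → interSize X Y ≡ P → E X Y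
    ∣X∩Y∣≡P⇒E X Y t≡P = R<∣X∩Y∣≤P⇒E X Y (subst (R <_) (sym t≡P) R<P) (≤-reflexive t≡P)

    commonNeighbour : (X Y : Vertex) → P + interSize X Y ≤ k → k ≤ r + interSize X Y + (P + P) →
                      Σ Vertex λ C → E X C × E C Y
    commonNeighbour X Y P+t≤k k≤r+t+2P =
      let C , ∣C∩X∣≡P , ∣C∩Y∣≡P = vertexWithOverlaps X Y P+t≤k P+t≤k d≤r+t (m+[n∸m]≡n P+P≤k)
      in C , ∣X∩Y∣≡P⇒E X C (trans (∣X∩Y∣≡∣Y∩X∣ X C) ∣C∩X∣≡P) , ∣X∩Y∣≡P⇒E C Y ∣C∩Y∣≡P
      where
      d≤r+t : k ∸ (P + P) ≤ r + interSize X Y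
      d≤r+t = m≤n+o⇒m∸n≤o k (P + P) (subst (k ≤_) (+-comm (r + interSize X Y) (P + P)) k≤r+t+2P)

    E-path⇒k≤r+P+P+∣A∩B∣ : (A C B : Vertex) → E A C → E C B → k ≤ r + P + P + interSize A B
    E-path⇒k≤r+P+P+∣A∩B∣ A C B A~C C~B = begin
      k                                              ≤⟨ k≤r+∣X∩Y∣+∣X∩Z∣+∣Y∩Z∣ C A B ⟩
      r + interSize C A + interSize C B + interSize A B
        ≤⟨ +-monoˡ-≤ (interSize A B) (+-mono-≤ (+-monoʳ-≤ r ∣C∩A∣≤P) (E⇒∣X∩Y∣≤P C B C~B)) ⟩
      r + P + P + interSize A B                      ∎
      where
      open ≤-Reasoning
      ∣C∩A∣≤P : interSize C A ≤ P
      ∣C∩A∣≤P = subst (_≤ P) (∣X∩Y∣≡∣Y∩X∣ A C) (E⇒∣X∩Y∣≤P A C A~C)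

    2rp+r≡r+P+P : 2 * r * p + r ≡ r + P + P
    2rp+r≡r+P+P = lemma r p
      where
      lemma : ∀ r p → 2 * r * p + r ≡ r + r * p + r * p
      lemma = solve-∀

    noShortEWalk : (A B : Vertex) → interSize A B ≤ R → ∀ m → m < 2 → ¬ Walk E A B m
    noShortEWalk A .A s≤R 0 _ here = <-irrefl (∣X∩X∣≡k A) (≤-<-trans s≤R (<-trans R<P P<k))
    noShortEWalk A B s≤R 1 _ (step A~B here) = ∣X∩Y∣≤R⇒¬E A B s≤R A~B
    noShortEWalk A B s≤R (suc (suc m)) (s≤s (s≤s ()))

    distanceTwo : (A B : Vertex) → interSize A B ≤ R → k ∸ (2 * r * p + r) ≤ interSize A B → Dist E A B 2
    distanceTwo A B s≤R k∸T≤s =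
      let C , A~C , C~B = commonNeighbour A B P+s≤k k≤r+s+2P
      in step {v = C} A~C (step C~B here) , noShortEWalk A B s≤R
      where
      open ≤-Reasoning
      s = interSize A B
      P+s≤k : P + s ≤ k
      P+s≤k = ≤-trans (+-monoʳ-≤ P (≤-trans s≤R (<⇒≤ R<P))) P+P≤k
      k≤r+s+2P : k ≤ r + s + (P + P)
      k≤r+s+2P = begin
        k                             ≤⟨ m≤n+m∸n k (2 * r * p + r) ⟩
        2 * r * p + r + (k ∸ (2 * r * p + r)) ≤⟨ +-monoʳ-≤ (2 * r * p + r) k∸T≤s ⟩
        2 * r * p + r + s             ≡⟨ cong (_+ s) 2rp+r≡r+P+P ⟩
        r + P + P + s                 ≡⟨ lemma r P s ⟩
        r + s + (P + P)               ∎
        where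
        lemma : ∀ r P s → r + P + P + s ≡ r + s + (P + P)
        lemma = solve-∀

    E-walk₃ : (A B : Vertex) → interSize A B ≤ P → Walk E A B 3
    E-walk₃ A B s≤P =
      let C , ∣C∩A∣≡P , ∣C∩B∣≡u = vertexWithOverlaps A B P+s≤k u+s≤k (m≤m+n r s) P+u+r≡k
          D , C~D , D~B = commonNeighbour C B (subst (λ x → P + x ≤ k) (sym ∣C∩B∣≡u) P+u≤k)
                                              (subst (λ x → k ≤ r + x + (P + P)) (sym ∣C∩B∣≡u) k≤r+u+2P)
      in step (∣X∩Y∣≡P⇒E A C (trans (∣X∩Y∣≡∣Y∩X∣ A C) ∣C∩A∣≡P)) (step {v = D} C~D (step D~B here))
      where
      open ≤-Reasoning
      s = interSize A B
      u = k ∸ (P + r)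
      P+r≤k : P + r ≤ k
      P+r≤k = ≤-trans (+-monoʳ-≤ P (m≤m*n r p)) P+P≤k
      P+r+u≡k : P + r + u ≡ k
      P+r+u≡k = m+[n∸m]≡n P+r≤k
      P+u+r≡k : P + u + r ≡ k
      P+u+r≡k = trans (m+n+o≡m+o+n P u r) P+r+u≡k
      P+s≤k : P + s ≤ k
      P+s≤k = ≤-trans (+-monoʳ-≤ P s≤P) P+P≤k
      u+s≤k : u + s ≤ k
      u+s≤k = begin
        u + s         ≤⟨ +-monoʳ-≤ u (≤-trans s≤P (m≤m+n P r)) ⟩
        u + (P + r)   ≡⟨ +-comm u (P + r) ⟩
        P + r + u     ≡⟨ P+r+u≡k ⟩
        k             ∎
      P+u≤k : P + u ≤ k
      P+u≤k = ≤-trans (+-monoˡ-≤ u (m≤m+n P r)) (≤-reflexive P+r+u≡k)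
      k≤r+u+2P : k ≤ r + u + (P + P)
      k≤r+u+2P = begin
        k               ≡⟨ P+r+u≡k ⟨
        P + r + u       ≤⟨ m≤m+n (P + r + u) P ⟩
        P + r + u + P   ≡⟨ lemma P r u ⟩
        r + u + (P + P) ∎
        where
        lemma : ∀ P r u → P + r + u + P ≡ r + u + (P + P)
        lemma = solve-∀

    distanceThree : (A B : Vertex) → interSize A B ≤ R → interSize A B < k ∸ (2 * r * p + r) →
                    Dist E A B 3
    distanceThree A B s≤R s<k∸T = E-walk₃ A B (≤-trans s≤R (<⇒≤ R<P)) , noShorter
      where
      noShorter : ∀ m → m < 3 → ¬ Walk E A B m
      noShorter 0 _ = noShortEWalk A B s≤R 0 z<s
      noShorter 1 _ = noShortEWalk A B s≤R 1 (s<s z<s)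
      noShorter 2 _ (step {v = C} A~C (step C~B here)) =
        <⇒≱ s<k∸T (m≤n+o⇒m∸n≤o k (2 * r * p + r)
          (subst (λ T → k ≤ T + interSize A B) (sym 2rp+r≡r+P+P) (E-path⇒k≤r+P+P+∣A∩B∣ A C B A~C C~B)))
      noShorter (suc (suc (suc m))) (s<s (s<s (s<s ())))


mainTheorem13 : (k r : ℕ) → 2 ≤ k → 1 ≤ r → r + 1 < k →
    (D : ℕ) → IsDiameter (KneserAdj (2 * k + r) k) D →
    (p : ℕ) → 1 ≤ p → 2 * p + 1 < D →
    (A B : KSet (2 * k + r) k) →
    interSize A B ≤ r * p ∸ r →
    ((k ∸ (2 * r * p + r) ≤ interSize A B →
        Dist (ExactDist (KneserAdj (2 * k + r) k) (2 * p + 1)) A B 2)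
     × (interSize A B < k ∸ (2 * r * p + r) →
        Dist (ExactDist (KneserAdj (2 * k + r) k) (2 * p + 1)) A B 3))
mainTheorem13 _ _ _ _ _ _ _ zero () _ _ _ _
mainTheorem13 k r _ r≥1 _ D diameter (suc p′) _ 2p+1<D A B s≤rp∸r =
  distanceTwo A B s≤rp′ , distanceThree A B s≤rp′
  where
  open Kneser k r
  2P+1<k : suc (r * suc p′ + r * suc p′) < k
  2P+1<k = diameter⇒2rp+1<k p′ diameter (subst (_< D) (2n+1≡suc[n+n] (suc p′)) 2p+1<D)
  open ExactDistance p′ r≥1 (<-trans (n<1+n _) 2P+1<k)
  s≤rp′ : interSize A B ≤ r * p′
  s≤rp′ = subst (interSize A B ≤_) (trans (cong (_∸ r) (*-suc r p′)) (m+n∸m≡n r (r * p′))) s≤rp∸r
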